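{- Let $\phi: K_n \to S_g$ be a cellular embedding of $K_n$ in the orientable surface of genus $g$, and let $F_c$ be a cotriangular patchwork of this embedding. Then the embedding of $K_n\times K_2$ obtained from $\phi$ and $F_c$ by the following construction is snug: take a mirror image $\phi'$ of $\phi$ (with each cell $c$ corresponding to a mirror cell $c'$); for each face $f\in F_c$, puncture the interiors of $f$ and its mirror $f'$ and connect the resulting boundaries with a tube; along this tube add the edge $(v,v')$ for every vertex $v$ incident with $f$ (adding each edge $(v,v')$ only once overall).
   Context: A facial cover of an embedded graph is a set of faces such that every vertex is incident with at least one of them. A cotriangular patchwork is a facial cover $F_c$ such that each vertex has exactly one incidence with the faces of $F_c$ (counting incidences along face boundary walks) and every face not in $F_c$ is triangular. $K_n\times K_2$ is the $n$-prism: two copies of $K_n$ plus the $n$ matching edges joining corresponding vertices. An embedding of $K_n\times K_2$ is snug if every face incident with at least one matching edge is 4-sided and every other face is 3-sided. -}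

module Defs where

open import Data.Nat using (ℕ; zero; suc; _<_)
open import Data.Fin using (Fin)
open import Data.Bool using (Bool; true; false; if_then_else_)
open import Data.Product using (Σ; ∃; _×_; _,_; proj₁; proj₂)
open import Data.Sum using (_⊎_; inj₁; inj₂)
open import Data.Empty using (⊥)
open import Relation.Nullary using (¬_)
open import Relation.Binary.PropositionalEquality using (_≡_; _≢_)

-- Combinatorial (Heffter–Edmonds) description of cellular embeddings of
-- a simple graph in orientable surfaces: rotation systems.
-- A rotation system is ρ : V → V → V, where ρ v u is the neighbour of v
-- following u in the cyclic order around v (values at non-neighbours
-- are irrelevant).

iter : {A : Set} → (A → A) → ℕ → A → A
iter f zero    x = x
iter f (suc k) x = f (iter f k x)

IsRotation : {V : Set} → (V → V → Set) → (V → V → V) → Set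
IsRotation {V} Adj ρ =
  (v : V) →
    ((u : V) → Adj v u → Adj v (ρ v u))
  × ((u u' : V) → Adj v u → Adj v u' → ρ v u ≡ ρ v u' → u ≡ u')
  × ((u u' : V) → Adj v u → Adj v u' → ∃ λ k → iter (ρ v) k u ≡ u')

-- Darts (oriented edges) are pairs (u , v) with Adj u v.  Faces = orbits of darts under faceStep;
-- the incidences of a vertex v with faces are exactly the darts with tail v
-- (one per corner at v).
faceStep : {V : Set} → (V → V → V) → V × V → V × V
faceStep ρ (u , v) = (v , ρ v u)

FaceLength : {V : Set} → (V → V → V) → V × V → ℕ → Set
FaceLength ρ d k =
  (0 < k) × (iter (faceStep ρ) k d ≡ d)
  × ((j : ℕ) → 0 < j → j < k → iter (faceStep ρ) j d ≢ d)

AdjK : (n : ℕ) → Fin n → Fin n → Set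
AdjK n u v = u ≢ v

-- A set of faces F_c is given as a Boolean predicate on darts which is
-- constant along face boundary walks (hence a union of faces).
IsFaceSet : {V : Set} → (V → V → Set) → (V → V → V) → (V × V → Bool) → Set
IsFaceSet {V} Adj ρ Fc =
  (u v : V) → Adj u v → Fc (faceStep ρ (u , v)) ≡ Fc (u , v)

IsFacialCover : {V : Set} → (V → V → Set) → (V → V → V) → (V × V → Bool) → Set
IsFacialCover {V} Adj ρ Fc =
  IsFaceSet Adj ρ Fc × ((v : V) → ∃ λ w → Adj v w × (Fc (v , w) ≡ true))

IsCotriangularPatchwork : {V : Set} → (V → V → Set) → (V → V → V) → (V × V → Bool) → Set
IsCotriangularPatchwork {V} Adj ρ Fc =
  IsFacialCover Adj ρ Fc
  × ((v w w' : V) → Adj v w → Adj v w' → Fc (v , w) ≡ true → Fc (v , w') ≡ true → w ≡ w')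
  × ((u v : V) → Adj u v → Fc (u , v) ≡ false → FaceLength ρ (u , v) 3)

-- The prism K_n × K_2: vertices inj₁ v (copy of φ) and inj₂ v (the
-- mirror vertex v').

PV : ℕ → Set
PV n = Fin n ⊎ Fin n

AdjP : (n : ℕ) → PV n → PV n → Set
AdjP n (inj₁ u) (inj₁ v) = u ≢ v
AdjP n (inj₂ u) (inj₂ v) = u ≢ v
AdjP n (inj₁ u) (inj₂ v) = u ≡ v
AdjP n (inj₂ u) (inj₁ v) = u ≡ v

IsMatchingDart : (n : ℕ) → PV n × PV n → Set
IsMatchingDart n (inj₁ u , inj₂ v) = u ≡ v
IsMatchingDart n (inj₂ u , inj₁ v) = u ≡ v
IsMatchingDart n (inj₁ u , inj₁ v) = ⊥
IsMatchingDart n (inj₂ u , inj₂ v) = ⊥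

-- The construction of the paper, as a (functional) relation between the
-- rotation system ρ of K_n, the patchwork Fc and the rotation system ρ'
-- of K_n × K_2:
--  * the mirror copy carries the reversed rotations (mirror image);
--  * at each vertex v, the unique corner of v lying in a face of Fc is the
--    corner between x and ρ v x with Fc (v , ρ v x) = true; the tube over
--    that face carries the matching edge v v', which is inserted into this
--    corner at v, and into the mirror corner at v' (between (ρ v x)' and x').
ConstructedRotation : (n : ℕ) → (Fin n → Fin n → Fin n) → (Fin n × Fin n → Bool)
  → (PV n → PV n → PV n) → Set
ConstructedRotation n ρ Fc ρ' =
    ((v x : Fin n) → x ≢ v →
       ρ' (inj₁ v) (inj₁ x) ≡ (if Fc (v , ρ v x) then inj₂ v else inj₁ (ρ v x)))
  × ((v x : Fin n) → x ≢ v → Fc (v , ρ v x) ≡ true →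
       ρ' (inj₁ v) (inj₂ v) ≡ inj₁ (ρ v x))
  × ((v x : Fin n) → x ≢ v →
       ρ' (inj₂ v) (inj₂ (ρ v x)) ≡ (if Fc (v , ρ v x) then inj₁ v else inj₂ x))
  × ((v x : Fin n) → x ≢ v → Fc (v , ρ v x) ≡ true →
       ρ' (inj₂ v) (inj₁ v) ≡ inj₂ x)

IsSnug : (n : ℕ) → (PV n → PV n → PV n) → Set
IsSnug n ρ' =
  (a b : PV n) → AdjP n a b →
    ((∃ λ k → IsMatchingDart n (iter (faceStep ρ') k (a , b))) → FaceLength ρ' (a , b) 4)
  × (¬ (∃ λ k → IsMatchingDart n (iter (faceStep ρ') k (a , b))) → FaceLength ρ' (a , b) 3)

{-# OPTIONS --safe #-}
module Submission where

-- Each vertex v meets the patch faces in a single corner, between patchIn v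
-- and patchOut v.  The rotation at v in the prism is the rotation of φ with
-- the matching edge vv' inserted into that corner, and the rotation at v' is
-- the reversed rotation with vv' inserted into the mirrored corner; inserting
-- a point into a cyclic permutation leaves it cyclic.  A face walk of the
-- prism through a non-patch dart never meets the inserted edges, so it runs
-- around a triangle of φ or around its mirror image.  A walk through the patch
-- dart (u , v) goes u → v → v' → u' → u, a quadrilateral.

open import Defs
open import Data.Nat using (ℕ; zero; suc; _+_; _<_; s≤s; z≤n)
open import Data.Fin using (Fin)
open import Data.Fin.Properties using (_≟_)
open import Data.Bool using (Bool; true; false; if_then_else_)
open import Data.Bool.Properties using (¬-not)
open import Data.Product using (Σ; ∃; _×_; _,_; proj₁; proj₂)
open import Data.Product.Properties using (,-injectiveˡ; ,-injectiveʳ)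
open import Data.Sum using (_⊎_; inj₁; inj₂)
open import Data.Sum.Properties using (inj₁-injective; inj₂-injective)
open import Function using (id; _∘_)
open import Relation.Nullary using (¬_; yes; no; contradiction)
open import Relation.Nullary.Decidable using (¬?)
open import Relation.Unary using (Decidable)
open import Relation.Binary.Definitions using (DecidableEquality)
open import Relation.Binary.PropositionalEquality

iter-suc : {A : Set} (f : A → A) (k : ℕ) (x : A) → iter f (suc k) x ≡ iter f k (f x)
iter-suc f zero    x = refl
iter-suc f (suc k) x = cong f (iter-suc f k x)

iter-+ : {A : Set} (f : A → A) (m k : ℕ) (x : A) → iter f (m + k) x ≡ iter f m (iter f k x)
iter-+ f zero    k x = refl
iter-+ f (suc m) k x = cong f (iter-+ f m k x)

iter-preserves : {A : Set} {P : A → Set} {f : A → A} →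
                 (∀ {x} → P x → P (f x)) → ∀ k {x} → P x → P (iter f k x)
iter-preserves                 pres zero        p = p
iter-preserves {P = P} {f = f} pres (suc k) {x} p = pres {iter f k x} (iter-preserves {P = P} pres k p)

Reaches : {A : Set} → (A → A) → A → A → Set
Reaches f a b = ∃ λ k → iter f k a ≡ b

reaches-trans : {A : Set} {f : A → A} {a b c : A} → Reaches f a b → Reaches f b c → Reaches f a c
reaches-trans {f = f} {a} (m , p) (k , q) = k + m , trans (iter-+ f k m a) (trans (cong (iter f k) p) q)

-- IsRotation Adj ρ unfolds to (v : V) → IsCyclicOn (Adj v) (ρ v).
IsCyclicOn : {A : Set} → (A → Set) → (A → A) → Set
IsCyclicOn {A} P σ =
    ((a : A) → P a → P (σ a))
  × ((a a' : A) → P a → P a' → σ a ≡ σ a' → a ≡ a')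
  × ((a a' : A) → P a → P a' → Reaches σ a a')

module Cyclic {A : Set} {P : A → Set} {σ : A → A} (cyclic : IsCyclicOn P σ) where

  closed : ∀ {a} → P a → P (σ a)
  closed = proj₁ cyclic _

  injective : ∀ {a a'} → P a → P a' → σ a ≡ σ a' → a ≡ a'
  injective = proj₁ (proj₂ cyclic) _ _

  connected : ∀ {a a'} → P a → P a' → Reaches σ a a'
  connected = proj₂ (proj₂ cyclic) _ _

  iter-closed : ∀ k {a} → P a → P (iter σ k a)
  iter-closed = iter-preserves closed

  surjective : ∀ {b} → P b → ∃ λ a → P a × σ a ≡ b
  surjective {b} Pb with connected (closed Pb) Pb
  ... | zero  , σb≡b = b , Pb , σb≡b
  ... | suc k , eq   = iter σ k (σ b) , iter-closed k (closed Pb) , eq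

inverse-isCyclicOn : {A : Set} {P : A → Set} {σ τ : A → A} →
                     IsCyclicOn P σ → (∀ {a} → P a → τ (σ a) ≡ a) → IsCyclicOn P τ
inverse-isCyclicOn {A = A} {P} {σ} {τ} cyclic τ-σ = closed , injective , connected
  where
  module σ = Cyclic cyclic

  closed : (b : A) → P b → P (τ b)
  closed _ Pb with σ.surjective Pb
  ... | a , Pa , refl = subst P (sym (τ-σ Pa)) Pa

  injective : (b b' : A) → P b → P b' → τ b ≡ τ b' → b ≡ b'
  injective _ _ Pb Pb' eq with σ.surjective Pb | σ.surjective Pb'
  ... | a , Pa , refl | a' , Pa' , refl = cong σ (trans (sym (τ-σ Pa)) (trans eq (τ-σ Pa')))

  undo : ∀ k {a} → P a → iter τ k (iter σ k a) ≡ a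
  undo zero    Pa = refl
  undo (suc k) {a} Pa = begin
    iter τ (suc k) (iter σ (suc k) a)  ≡⟨ iter-suc τ k _ ⟩
    iter τ k (τ (σ (iter σ k a)))      ≡⟨ cong (iter τ k) (τ-σ (σ.iter-closed k Pa)) ⟩
    iter τ k (iter σ k a)              ≡⟨ undo k Pa ⟩
    a                                  ∎
    where open ≡-Reasoning

  connected : (b b' : A) → P b → P b' → Reaches τ b b'
  connected _ _ Pb Pb' with σ.connected Pb' Pb
  ... | k , refl = k , undo k Pb'

module Inverse {A : Set} {P : A → Set} {σ : A → A}
               (cyclic : IsCyclicOn P σ) (P? : Decidable P) where

  open Cyclic cyclic

  -- Off P the value of σ⁻¹ is irrelevant.
  σ⁻¹ : A → A
  σ⁻¹ b with P? b
  ... | yes Pb = proj₁ (surjective Pb)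
  ... | no  _  = b

  σ⁻¹-spec : ∀ {b} → P b → P (σ⁻¹ b) × σ (σ⁻¹ b) ≡ b
  σ⁻¹-spec {b} Pb with P? b
  ... | yes Pb' = proj₂ (surjective Pb')
  ... | no ¬Pb  = contradiction Pb ¬Pb

  σ⁻¹-closed : ∀ {b} → P b → P (σ⁻¹ b)
  σ⁻¹-closed = proj₁ ∘ σ⁻¹-spec

  σ-σ⁻¹ : ∀ {b} → P b → σ (σ⁻¹ b) ≡ b
  σ-σ⁻¹ = proj₂ ∘ σ⁻¹-spec

  σ⁻¹-σ : ∀ {a} → P a → σ⁻¹ (σ a) ≡ a
  σ⁻¹-σ Pa = injective (σ⁻¹-closed (closed Pa)) Pa (σ-σ⁻¹ (closed Pa))

  σ⁻¹-cyclic : IsCyclicOn P σ⁻¹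
  σ⁻¹-cyclic = inverse-isCyclicOn cyclic σ⁻¹-σ

-- τ acts on a copy e of the points of σ together with a new point z, which it
-- inserts into the cycle of σ between c and σ c.
module Insertion
  {A B : Set} {P : A → Set} {σ : A → A} (σ-cyclic : IsCyclicOn P σ) (_≟ᴬ_ : DecidableEquality A)
  {Q : B → Set} {τ : B → B}
  (e : A → B) (e-injective : ∀ {a a'} → e a ≡ e a' → a ≡ a')
  (z : B) (e≢z : ∀ {a} → e a ≢ z)
  (Q-view : ∀ {b} → Q b → b ≡ z ⊎ ∃ λ a → P a × e a ≡ b)
  (Q-e : ∀ {a} → P a → Q (e a)) (Q-z : Q z)
  (c : A) (P-c : P c)
  (τ-c : τ (e c) ≡ z) (τ-z : τ z ≡ e (σ c)) (τ-e : ∀ {a} → P a → a ≢ c → τ (e a) ≡ e (σ a))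
  where

  private module σ = Cyclic σ-cyclic

  closed : (b : B) → Q b → Q (τ b)
  closed _ Qb with Q-view Qb
  ... | inj₁ refl = subst Q (sym τ-z) (Q-e (σ.closed P-c))
  ... | inj₂ (a , Pa , refl) with a ≟ᴬ c
  ...   | yes refl = subst Q (sym τ-c) Q-z
  ...   | no  a≢c  = subst Q (sym (τ-e Pa a≢c)) (Q-e (σ.closed Pa))

  τb≡z⇒b≡ec : ∀ {b} → Q b → τ b ≡ z → b ≡ e c
  τb≡z⇒b≡ec Qb eq with Q-view Qb
  ... | inj₁ refl = contradiction (trans (sym τ-z) eq) e≢z
  ... | inj₂ (a , Pa , refl) with a ≟ᴬ c
  ...   | yes refl = refl
  ...   | no  a≢c  = contradiction (trans (sym (τ-e Pa a≢c)) eq) e≢z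

  τb≡eσc⇒b≡z : ∀ {b} → Q b → τ b ≡ e (σ c) → b ≡ z
  τb≡eσc⇒b≡z Qb eq with Q-view Qb
  ... | inj₁ refl = refl
  ... | inj₂ (a , Pa , refl) with a ≟ᴬ c
  ...   | yes refl = contradiction (trans (sym eq) τ-c) e≢z
  ...   | no  a≢c  = contradiction (σ.injective Pa P-c (e-injective (trans (sym (τ-e Pa a≢c)) eq))) a≢c

  injective : (b b' : B) → Q b → Q b' → τ b ≡ τ b' → b ≡ b'
  injective _ _ Qb Qb' eq with Q-view Qb | Q-view Qb'
  ... | inj₁ refl | _         = sym (τb≡eσc⇒b≡z Qb' (trans (sym eq) τ-z))
  ... | _         | inj₁ refl = τb≡eσc⇒b≡z Qb (trans eq τ-z)
  ... | inj₂ (a , Pa , refl) | inj₂ (a' , Pa' , refl) with a ≟ᴬ c | a' ≟ᴬ c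
  ...   | yes refl | _        = sym (τb≡z⇒b≡ec Qb' (trans (sym eq) τ-c))
  ...   | _        | yes refl = τb≡z⇒b≡ec Qb (trans eq τ-c)
  ...   | no a≢c   | no a'≢c  =
    cong e (σ.injective Pa Pa' (e-injective (trans (sym (τ-e Pa a≢c)) (trans eq (τ-e Pa' a'≢c)))))

  reaches-z : ∀ k {a} → P a → iter σ k a ≡ c → Reaches τ (e a) z
  reaches-z k {a} Pa σᵏa≡c with a ≟ᴬ c
  reaches-z k       Pa σᵏa≡c | yes refl = 1 , τ-c
  reaches-z zero    Pa σᵏa≡c | no  a≢c  = contradiction σᵏa≡c a≢c
  reaches-z (suc k) Pa σᵏa≡c | no  a≢c  =
    reaches-trans (1 , τ-e Pa a≢c) (reaches-z k (σ.closed Pa) (trans (sym (iter-suc σ k _)) σᵏa≡c))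

  z-reaches : ∀ k → Reaches τ z (e (iter σ k (σ c)))
  z-reaches zero = 1 , τ-z
  z-reaches (suc k) with iter σ k (σ c) ≟ᴬ c
  ... | yes eq = 1 , trans τ-z (cong (e ∘ σ) (sym eq))
  ... | no  ne = reaches-trans (z-reaches k) (1 , τ-e (σ.iter-closed k (σ.closed P-c)) ne)

  connected : (b b' : B) → Q b → Q b' → Reaches τ b b'
  connected _ _ Qb Qb' = reaches-trans (to-z Qb) (from-z Qb')
    where
    to-z : ∀ {b} → Q b → Reaches τ b z
    to-z Qb with Q-view Qb
    ... | inj₁ refl = 0 , refl
    ... | inj₂ (a , Pa , refl) with σ.connected Pa P-c
    ...   | k , σᵏa≡c = reaches-z k Pa σᵏa≡c
    from-z : ∀ {b} → Q b → Reaches τ z b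
    from-z Qb with Q-view Qb
    ... | inj₁ refl = 0 , refl
    ... | inj₂ (a , Pa , refl) with σ.connected (σ.closed P-c) Pa
    ...   | k , refl = z-reaches k

  isCyclicOn : IsCyclicOn Q τ
  isCyclicOn = closed , injective , connected

triangle : {V : Set} {ρ : V → V → V} (R : V × V → Set) {d₀ d₁ d₂ : V × V} →
           faceStep ρ d₀ ≡ d₁ → faceStep ρ d₁ ≡ d₂ → faceStep ρ d₂ ≡ d₀ →
           d₁ ≢ d₀ → d₂ ≢ d₀ → R d₀ → R d₁ → R d₂ →
           FaceLength ρ d₀ 3 × (∀ k → R (iter (faceStep ρ) k d₀))
triangle {V = V} {ρ} R {d₀} {d₁} {d₂} e₀ e₁ e₂ d₁≢d₀ d₂≢d₀ R₀ R₁ R₂ =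
  (s≤s z≤n , trans (cong (faceStep ρ) two) e₂ , distinct) ,
  λ k → on-R (iter-preserves {P = OnTriangle} step k (inj₁ refl))
  where
  two : iter (faceStep ρ) 2 d₀ ≡ d₂
  two = trans (cong (faceStep ρ) e₀) e₁

  distinct : (j : ℕ) → 0 < j → j < 3 → iter (faceStep ρ) j d₀ ≢ d₀
  distinct 1 _ _ = subst (_≢ d₀) (sym e₀) d₁≢d₀
  distinct 2 _ _ = subst (_≢ d₀) (sym two) d₂≢d₀
  distinct (suc (suc (suc _))) _ (s≤s (s≤s (s≤s ())))

  OnTriangle : V × V → Set
  OnTriangle d = d ≡ d₀ ⊎ d ≡ d₁ ⊎ d ≡ d₂

  step : ∀ {d} → OnTriangle d → OnTriangle (faceStep ρ d)
  step (inj₁ refl)        = inj₂ (inj₁ e₀)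
  step (inj₂ (inj₁ refl)) = inj₂ (inj₂ e₁)
  step (inj₂ (inj₂ refl)) = inj₁ e₂

  on-R : ∀ {d} → OnTriangle d → R d
  on-R (inj₁ refl)        = R₀
  on-R (inj₂ (inj₁ refl)) = R₁
  on-R (inj₂ (inj₂ refl)) = R₂

quadrilateral : {V : Set} {ρ : V → V → V} {d₀ d₁ d₂ d₃ : V × V} →
                faceStep ρ d₀ ≡ d₁ → faceStep ρ d₁ ≡ d₂ → faceStep ρ d₂ ≡ d₃ → faceStep ρ d₃ ≡ d₀ →
                d₁ ≢ d₀ → d₂ ≢ d₀ → d₃ ≢ d₀ → FaceLength ρ d₀ 4
quadrilateral {ρ = ρ} {d₀} e₀ e₁ e₂ e₃ d₁≢d₀ d₂≢d₀ d₃≢d₀ =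
  s≤s z≤n , trans (cong (faceStep ρ) three) e₃ , distinct
  where
  two : iter (faceStep ρ) 2 d₀ ≡ _
  two = trans (cong (faceStep ρ) e₀) e₁

  three : iter (faceStep ρ) 3 d₀ ≡ _
  three = trans (cong (faceStep ρ) two) e₂

  distinct : (j : ℕ) → 0 < j → j < 4 → iter (faceStep ρ) j d₀ ≢ d₀
  distinct 1 _ _ = subst (_≢ d₀) (sym e₀) d₁≢d₀
  distinct 2 _ _ = subst (_≢ d₀) (sym two) d₂≢d₀
  distinct 3 _ _ = subst (_≢ d₀) (sym three) d₃≢d₀
  distinct (suc (suc (suc (suc _)))) _ (s≤s (s≤s (s≤s (s≤s ()))))

module Patchwork {n : ℕ} {ρ : Fin n → Fin n → Fin n} {Fc : Fin n × Fin n → Bool}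
                 (rotation : IsRotation (AdjK n) ρ)
                 (patchwork : IsCotriangularPatchwork (AdjK n) ρ Fc) where

  module ρ-at (v : Fin n) = Cyclic (rotation v)
  module ρ⁻¹-at (v : Fin n) = Inverse (rotation v) (λ x → ¬? (v ≟ x))

  ρ⁻¹ : Fin n → Fin n → Fin n
  ρ⁻¹ v = ρ⁻¹-at.σ⁻¹ v

  Fc-faceStep : ∀ {u v} → u ≢ v → Fc (v , ρ v u) ≡ Fc (u , v)
  Fc-faceStep = proj₁ (proj₁ patchwork) _ _

  -- The patch face through v arrives along (patchIn v , v) and leaves along
  -- (v , patchOut v); this is the only corner of v in a patch face.
  patchOut : Fin n → Fin n
  patchOut v = proj₁ (proj₂ (proj₁ patchwork) v)

  patchOut-adj : ∀ {v} → v ≢ patchOut v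
  patchOut-adj {v} = proj₁ (proj₂ (proj₂ (proj₁ patchwork) v))

  Fc-patchOut : ∀ {v} → Fc (v , patchOut v) ≡ true
  Fc-patchOut {v} = proj₂ (proj₂ (proj₂ (proj₁ patchwork) v))

  patchOut-unique : ∀ {v w} → v ≢ w → Fc (v , w) ≡ true → w ≡ patchOut v
  patchOut-unique v≢w patch = proj₁ (proj₂ patchwork) _ _ _ v≢w patchOut-adj patch Fc-patchOut

  patchIn : Fin n → Fin n
  patchIn v = ρ⁻¹ v (patchOut v)

  patchIn-adj : ∀ {v} → v ≢ patchIn v
  patchIn-adj {v} = ρ⁻¹-at.σ⁻¹-closed v patchOut-adj

  ρ-patchIn : ∀ {v} → ρ v (patchIn v) ≡ patchOut v
  ρ-patchIn {v} = ρ⁻¹-at.σ-σ⁻¹ v patchOut-adj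

  Fc-ρ-patchIn : ∀ {v} → Fc (v , ρ v (patchIn v)) ≡ true
  Fc-ρ-patchIn = trans (cong (λ w → Fc (_ , w)) ρ-patchIn) Fc-patchOut

  Fc-patchIn : ∀ {v} → Fc (patchIn v , v) ≡ true
  Fc-patchIn = trans (sym (Fc-faceStep (≢-sym patchIn-adj))) Fc-ρ-patchIn

  patchIn-unique : ∀ {v x} → v ≢ x → Fc (v , ρ v x) ≡ true → x ≡ patchIn v
  patchIn-unique {v} v≢x patch =
    ρ-at.injective v v≢x patchIn-adj (trans (patchOut-unique (ρ-at.closed v v≢x) patch) (sym ρ-patchIn))

  Fc-off-patchOut : ∀ {v w} → v ≢ w → w ≢ patchOut v → Fc (v , w) ≡ false
  Fc-off-patchOut v≢w w≢patchOut = ¬-not (w≢patchOut ∘ patchOut-unique v≢w)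

  Fc-off-patchIn : ∀ {v x} → v ≢ x → x ≢ patchIn v → Fc (v , ρ v x) ≡ false
  Fc-off-patchIn v≢x x≢patchIn = ¬-not (x≢patchIn ∘ patchIn-unique v≢x)

  NonPatchCorner : Fin n → Fin n → Fin n → Set
  NonPatchCorner u v w = u ≢ v × ρ v u ≡ w × Fc (v , w) ≡ false

  nonPatch-triangle : ∀ {u v} → u ≢ v → Fc (u , v) ≡ false →
                      let w = ρ v u in NonPatchCorner u v w × NonPatchCorner v w u × NonPatchCorner w u v
  nonPatch-triangle {u} {v} u≢v off =
    (u≢v , refl , off₁) , (v≢w , ρwv≡u , off₂) , (w≢u , ρuw≡v , off)
    where
    w : Fin n
    w = ρ v u

    closes : (ρ w v , ρ (ρ w v) w) ≡ (u , v)
    closes = proj₁ (proj₂ (proj₂ (proj₂ patchwork) u v u≢v off))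

    ρwv≡u : ρ w v ≡ u
    ρwv≡u = cong proj₁ closes

    ρuw≡v : ρ u w ≡ v
    ρuw≡v = subst (λ t → ρ t w ≡ v) ρwv≡u (cong proj₂ closes)

    v≢w : v ≢ w
    v≢w = ρ-at.closed v (≢-sym u≢v)

    w≢u : w ≢ u
    w≢u w≡u = ρ-at.closed w (≢-sym v≢w) (sym (trans ρwv≡u (sym w≡u)))

    off₁ : Fc (v , w) ≡ false
    off₁ = trans (Fc-faceStep u≢v) off

    off₂ : Fc (w , u) ≡ false
    off₂ = trans (cong (λ t → Fc (w , t)) (sym ρwv≡u)) (trans (Fc-faceStep v≢w) off₁)

  prismRotation : PV n → PV n → PV n
  prismRotation (inj₁ v) (inj₁ x) = if Fc (v , ρ v x) then inj₂ v else inj₁ (ρ v x)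
  prismRotation (inj₁ v) (inj₂ _) = inj₁ (patchOut v)
  prismRotation (inj₂ v) (inj₂ y) = if Fc (v , y) then inj₁ v else inj₂ (ρ⁻¹ v y)
  prismRotation (inj₂ v) (inj₁ _) = inj₂ (patchIn v)

  prismRotation-constructed : ConstructedRotation n ρ Fc prismRotation
  prismRotation-constructed =
      (λ _ _ _ → refl)
    , (λ v x x≢v patch → cong inj₁ (sym (patchOut-unique (ρ-at.closed v (≢-sym x≢v)) patch)))
    , (λ v x x≢v → cong (λ y → if Fc (v , ρ v x) then inj₁ v else inj₂ y) (ρ⁻¹-at.σ⁻¹-σ v (≢-sym x≢v)))
    , (λ v x x≢v patch → cong inj₂ (sym (patchIn-unique (≢-sym x≢v) patch)))

  module Prism {ρ' : PV n → PV n → PV n} (constructed : ConstructedRotation n ρ Fc ρ') where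

    ρ'-copy : ∀ {v x} → v ≢ x → Fc (v , ρ v x) ≡ false → ρ' (inj₁ v) (inj₁ x) ≡ inj₁ (ρ v x)
    ρ'-copy {v} {x} v≢x off rewrite proj₁ constructed v x (≢-sym v≢x) | off = refl

    ρ'-copy-patchIn : ∀ {v} → ρ' (inj₁ v) (inj₁ (patchIn v)) ≡ inj₂ v
    ρ'-copy-patchIn {v} rewrite proj₁ constructed v (patchIn v) (≢-sym patchIn-adj) | Fc-ρ-patchIn {v} = refl

    ρ'-copy-rung : ∀ {v} → ρ' (inj₁ v) (inj₂ v) ≡ inj₁ (patchOut v)
    ρ'-copy-rung {v} =
      trans (proj₁ (proj₂ constructed) v (patchIn v) (≢-sym patchIn-adj) Fc-ρ-patchIn) (cong inj₁ ρ-patchIn)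

    ρ'-mirror : ∀ {v x} → v ≢ x → Fc (v , ρ v x) ≡ false → ρ' (inj₂ v) (inj₂ (ρ v x)) ≡ inj₂ x
    ρ'-mirror {v} {x} v≢x off rewrite proj₁ (proj₂ (proj₂ constructed)) v x (≢-sym v≢x) | off = refl

    ρ'-mirror-patchOut : ∀ {v} → ρ' (inj₂ v) (inj₂ (patchOut v)) ≡ inj₁ v
    ρ'-mirror-patchOut {v}
      rewrite sym (ρ-patchIn {v}) | proj₁ (proj₂ (proj₂ constructed)) v (patchIn v) (≢-sym patchIn-adj)
            | Fc-ρ-patchIn {v} = refl

    ρ'-mirror-rung : ∀ {v} → ρ' (inj₂ v) (inj₁ v) ≡ inj₂ (patchIn v)
    ρ'-mirror-rung {v} = proj₂ (proj₂ (proj₂ constructed)) v (patchIn v) (≢-sym patchIn-adj) Fc-ρ-patchIn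

    copy-cyclic : ∀ v → IsCyclicOn (AdjP n (inj₁ v)) (ρ' (inj₁ v))
    copy-cyclic v =
      Insertion.isCyclicOn (rotation v) _≟_ inj₁ inj₁-injective (inj₂ v) (λ ()) view id refl
        (patchIn v) patchIn-adj ρ'-copy-patchIn (trans ρ'-copy-rung (cong inj₁ (sym ρ-patchIn)))
        (λ v≢a a≢patchIn → ρ'-copy v≢a (Fc-off-patchIn v≢a a≢patchIn))
      where
      view : ∀ {b} → AdjP n (inj₁ v) b → b ≡ inj₂ v ⊎ ∃ λ a → v ≢ a × inj₁ a ≡ b
      view {inj₁ a} v≢a  = inj₂ (a , v≢a , refl)
      view {inj₂ _} refl = inj₁ refl

    ρ'-mirror-off : ∀ {v y} → v ≢ y → y ≢ patchOut v → ρ' (inj₂ v) (inj₂ y) ≡ inj₂ (ρ⁻¹ v y)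
    ρ'-mirror-off {v} {y} v≢y y≢patchOut
      with ρ⁻¹ v y | ρ⁻¹-at.σ⁻¹-closed v v≢y | ρ⁻¹-at.σ-σ⁻¹ v v≢y
    ... | x | v≢x | refl = ρ'-mirror v≢x (Fc-off-patchOut v≢y y≢patchOut)

    mirror-cyclic : ∀ v → IsCyclicOn (AdjP n (inj₂ v)) (ρ' (inj₂ v))
    mirror-cyclic v =
      Insertion.isCyclicOn (ρ⁻¹-at.σ⁻¹-cyclic v) _≟_ inj₂ inj₂-injective (inj₁ v) (λ ()) view id refl
        (patchOut v) patchOut-adj ρ'-mirror-patchOut ρ'-mirror-rung ρ'-mirror-off
      where
      view : ∀ {b} → AdjP n (inj₂ v) b → b ≡ inj₁ v ⊎ ∃ λ a → v ≢ a × inj₂ a ≡ b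
      view {inj₂ a} v≢a  = inj₂ (a , v≢a , refl)
      view {inj₁ _} refl = inj₁ refl

    isRotation : IsRotation (AdjP n) ρ'
    isRotation (inj₁ v) = copy-cyclic v
    isRotation (inj₂ v) = mirror-cyclic v

    OnMatchingFace : PV n × PV n → Set
    OnMatchingFace d = ∃ λ k → IsMatchingDart n (iter (faceStep ρ') k d)

    SnugAt : PV n × PV n → Set
    SnugAt d = (OnMatchingFace d → FaceLength ρ' d 4) × (¬ OnMatchingFace d → FaceLength ρ' d 3)

    snug-quadrilateral : ∀ {d} → FaceLength ρ' d 4 → OnMatchingFace d → SnugAt d
    snug-quadrilateral length₄ matching = (λ _ → length₄) , contradiction matching

    snug-triangle : ∀ {d} → FaceLength ρ' d 3 × (∀ k → ¬ IsMatchingDart n (iter (faceStep ρ') k d)) → SnugAt d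
    snug-triangle (length₃ , unmatched) = (λ (k , m) → contradiction m (unmatched k)) , λ _ → length₃

    copy-step : ∀ {u v w} → NonPatchCorner u v w → faceStep ρ' (inj₁ u , inj₁ v) ≡ (inj₁ v , inj₁ w)
    copy-step (u≢v , refl , off) = cong (_ ,_) (ρ'-copy (≢-sym u≢v) off)

    mirror-step : ∀ {u v w} → NonPatchCorner u v w → faceStep ρ' (inj₂ w , inj₂ v) ≡ (inj₂ v , inj₂ u)
    mirror-step (u≢v , refl , off) = cong (_ ,_) (ρ'-mirror (≢-sym u≢v) off)

    copy-triangle : ∀ {u v} → u ≢ v → Fc (u , v) ≡ false → SnugAt (inj₁ u , inj₁ v)
    copy-triangle u≢v off with nonPatch-triangle u≢v off
    ... | c₀ , c₁ , c₂ =
      snug-triangle (triangle (¬_ ∘ IsMatchingDart n) (copy-step c₀) (copy-step c₁) (copy-step c₂)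
        (u≢v ∘ sym ∘ inj₁-injective ∘ ,-injectiveˡ) (u≢v ∘ inj₁-injective ∘ ,-injectiveʳ)
        (λ ()) (λ ()) (λ ()))

    mirror-triangle : ∀ {u v} → u ≢ v → Fc (u , v) ≡ false → SnugAt (inj₂ v , inj₂ u)
    mirror-triangle u≢v off with nonPatch-triangle u≢v off
    ... | c₀ , c₁ , c₂ =
      snug-triangle (triangle (¬_ ∘ IsMatchingDart n) (mirror-step c₂) (mirror-step c₁) (mirror-step c₀)
        (u≢v ∘ inj₂-injective ∘ ,-injectiveˡ) (u≢v ∘ sym ∘ inj₂-injective ∘ ,-injectiveʳ)
        (λ ()) (λ ()) (λ ()))

    module PatchQuadrilateral {u v} (u≢v : u ≢ v) (patch : Fc (u , v) ≡ true) where

      u≡patchIn : u ≡ patchIn v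
      u≡patchIn = patchIn-unique (≢-sym u≢v) (trans (Fc-faceStep u≢v) patch)

      v≡patchOut : v ≡ patchOut u
      v≡patchOut = patchOut-unique u≢v patch

      step₀ : faceStep ρ' (inj₁ u , inj₁ v) ≡ (inj₁ v , inj₂ v)
      step₀ = cong (_ ,_) (subst (λ x → ρ' (inj₁ v) (inj₁ x) ≡ inj₂ v) (sym u≡patchIn) ρ'-copy-patchIn)

      step₁ : faceStep ρ' (inj₁ v , inj₂ v) ≡ (inj₂ v , inj₂ u)
      step₁ = cong (_ ,_) (trans ρ'-mirror-rung (cong inj₂ (sym u≡patchIn)))

      step₂ : faceStep ρ' (inj₂ v , inj₂ u) ≡ (inj₂ u , inj₁ u)
      step₂ = cong (_ ,_) (subst (λ y → ρ' (inj₂ u) (inj₂ y) ≡ inj₁ u) (sym v≡patchOut) ρ'-mirror-patchOut)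

      step₃ : faceStep ρ' (inj₂ u , inj₁ u) ≡ (inj₁ u , inj₁ v)
      step₃ = cong (_ ,_) (trans ρ'-copy-rung (cong inj₁ (sym v≡patchOut)))

      snug₀ : SnugAt (inj₁ u , inj₁ v)
      snug₀ = snug-quadrilateral (quadrilateral step₀ step₁ step₂ step₃ (λ ()) (λ ()) (λ ()))
                                 (1 , subst (IsMatchingDart n) (sym step₀) refl)

      snug₁ : SnugAt (inj₁ v , inj₂ v)
      snug₁ = snug-quadrilateral (quadrilateral step₁ step₂ step₃ step₀ (λ ()) (λ ()) (λ ())) (0 , refl)

      snug₂ : SnugAt (inj₂ v , inj₂ u)
      snug₂ = snug-quadrilateral (quadrilateral step₂ step₃ step₀ step₁ (λ ()) (λ ()) (λ ()))
                                 (1 , subst (IsMatchingDart n) (sym step₂) refl)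

      snug₃ : SnugAt (inj₂ u , inj₁ u)
      snug₃ = snug-quadrilateral (quadrilateral step₃ step₀ step₁ step₂ (λ ()) (λ ()) (λ ())) (0 , refl)

    isSnug : IsSnug n ρ'
    isSnug (inj₁ u) (inj₁ v) u≢v with Fc (u , v) in fc
    ... | true  = PatchQuadrilateral.snug₀ u≢v fc
    ... | false = copy-triangle u≢v fc
    isSnug (inj₂ v) (inj₂ u) v≢u with Fc (u , v) in fc
    ... | true  = PatchQuadrilateral.snug₂ (≢-sym v≢u) fc
    ... | false = mirror-triangle (≢-sym v≢u) fc
    isSnug (inj₁ v) (inj₂ _) refl = PatchQuadrilateral.snug₁ (≢-sym patchIn-adj) Fc-patchIn
    isSnug (inj₂ u) (inj₁ _) refl = PatchQuadrilateral.snug₃ patchOut-adj Fc-patchOut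

proposition3p4 : (n : ℕ) (ρ : Fin n → Fin n → Fin n) (Fc : Fin n × Fin n → Bool)
    → IsRotation (AdjK n) ρ
    → IsCotriangularPatchwork (AdjK n) ρ Fc
    → Σ (PV n → PV n → PV n) (ConstructedRotation n ρ Fc)
      × ((ρ' : PV n → PV n → PV n) → ConstructedRotation n ρ Fc ρ'
          → IsRotation (AdjP n) ρ' × IsSnug n ρ')
proposition3p4 n ρ Fc rotation patchwork =
  (prismRotation , prismRotation-constructed) ,
  λ ρ' constructed → Prism.isRotation constructed , Prism.isSnug constructed
  where open Patchwork rotation patchwork
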